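{- Let $\mathbf z$ be the infinite fixed point, starting with $a$, of the morphism $h$ with $h(a)=aab$, $h(b)=b$, and let $\rho_{\mathbf z}(n)$ be the number of distinct length-$n$ factors of $\mathbf z$. The sequence $(\rho_{\mathbf z}(n+1)-\rho_{\mathbf z}(n))_{n\ge 0}$ equals the concatenation $$\prod_{i\ge 0}[2^i..2^{i+1}]=(1,2,2,3,4,4,5,6,7,8,8,9,\ldots),$$ where $[i..j]$ denotes the finite sequence $i,i+1,\ldots,j$.
   Context: A factor of an infinite word is a finite contiguous block of it. -}

module Defs where

open import Data.Nat using (ℕ; zero; suc; _+_; _*_; _^_; _<_; _∸_)
open import Data.List using (List; []; _∷_; map; upTo; concatMap; length; take; applyUpTo; lookup)
open import Data.List.Relation.Unary.All using (All)
open import Data.List.Relation.Unary.Unique.Propositional using (Unique)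
open import Data.List.Membership.Propositional using (_∈_)
open import Data.Product using (Σ; ∃; ∃-syntax; _×_)
open import Relation.Binary.PropositionalEquality using (_≡_)

data Letter : Set where
  a b : Letter

Word : Set
Word = List Letter

InfWord : Set
InfWord = ℕ → Letter

hL : Letter → Word
hL a = a ∷ a ∷ b ∷ []
hL b = b ∷ []

h : Word → Word
h = concatMap hL

h^ : ℕ → Word → Word
h^ zero w = w
h^ (suc k) w = h (h^ k w)

prefix : InfWord → ℕ → Word
prefix z n = applyUpTo z n

-- z is the infinite fixed point of h starting with a, i.e. the limit of the
-- words h^k(a): every h^k(a) is a prefix of z.
IsFixedPointFromA : InfWord → Set
IsFixedPointFromA z = ∀ k → prefix z (length (h^ k (a ∷ []))) ≡ h^ k (a ∷ [])

slice : InfWord → ℕ → ℕ → Word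
slice z i n = applyUpTo (λ j → z (i + j)) n

IsFactor : InfWord → Word → Set
IsFactor z w = ∃[ i ] slice z i (length w) ≡ w

IsComplexity : InfWord → ℕ → ℕ → Set
IsComplexity z n k =
  Σ (List Word) λ L →
    Unique L
    × All (λ w → length w ≡ n × IsFactor z w) L
    × (∀ w → length w ≡ n → IsFactor z w → w ∈ L)
    × length L ≡ k

interval : ℕ → ℕ → List ℕ
interval i j = applyUpTo (i +_) (suc (j ∸ i))

-- The concatenation of the blocks [2^i..2^(i+1)] for i = 0, ..., k-1;
-- the infinite concatenation ∏_{i≥0} is the limit of these prefixes.
blocks : ℕ → List ℕ
blocks k = concatMap (λ i → interval (2 ^ i) (2 ^ suc i)) (upTo k)

-- A factor w is right special when wa and wb are both factors. Every factor extends to the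
-- right, by two letters exactly when it is right special, so ρ(n+1) − ρ(n) is the number of
-- right special factors of length n. Since aaa and bab are not factors, a right special factor
-- y aab bᵗ desubstitutes under h to a shorter right special factor, and induction on the length
-- shows that the right special factors are exactly the suffixes of the words bᴷ hᴷ(a) bᵗ.
-- As bᴷ hᴷ(a) = rev(hᴷ(a)) bᴷ and |hᴷ(a)| = 2ᴷ⁺¹ − 1, those of length n are rev(z[0..ℓ)) bⁿ⁻ˡ
-- for the ℓ ≤ n with ℓ < 2ⁿ⁻ˡ⁺¹. This condition is downward closed in ℓ, and its threshold v
-- satisfies n + 1 = v + i with 2ⁱ ≤ v ≤ 2ⁱ⁺¹, which is exactly how the blocks [2ⁱ..2ⁱ⁺¹] are laid out.

module Submission where

open import Defs
open import Data.Nat using (ℕ; zero; suc; _+_; _*_; _^_; _<_; _≤_; _∸_; z≤n; s≤s)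
open import Data.Nat.Properties
open import Data.Nat.Tactic.RingSolver using (solve-∀)
open import Data.List using (List; []; _∷_; _++_; [_]; _∷ʳ_; length; lookup; map; concatMap; applyUpTo; upTo; replicate; reverse; take; drop; filter)
open import Data.List.Properties
open import Data.List.Relation.Unary.All as All using (All; []; _∷_)
open import Data.List.Relation.Unary.Any using (here; there)
open import Data.List.Relation.Unary.AllPairs using ([]; _∷_)
open import Data.List.Relation.Unary.Unique.Propositional using (Unique)
import Data.List.Relation.Unary.Unique.Propositional.Properties as Unique
open import Data.List.Membership.Propositional using (_∈_)
open import Data.List.Membership.Propositional.Properties using (∈-filter⁺; ∈-filter⁻; ∈-map⁺; ∈-upTo⁺)
import Data.List.Relation.Unary.All.Properties as All
open import Data.List.Membership.Propositional.Properties.WithK using (unique∧set⇒bag)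
open import Data.List.Membership.DecPropositional using (_∈?_)
open import Data.List.Relation.Binary.BagAndSetEquality using (∼bag⇒↭)
open import Data.List.Relation.Binary.Permutation.Propositional.Properties using (↭-length)
open import Function.Bundles using (mk⇔)
open import Data.Fin using (fromℕ<)
open import Data.Product using (∃₂; ∃-syntax; _×_; _,_; proj₁; proj₂) renaming (map to ×-map)
open import Data.Sum using (_⊎_; inj₁; inj₂)
open import Data.Empty using (⊥-elim)
open import Relation.Nullary using (¬_; Dec; yes; no)
open import Relation.Nullary.Decidable using (_×-dec_)
open import Relation.Binary.PropositionalEquality hiding ([_])
open import Function using (_∘_; id)
open import Algebra.Solver.Monoid (++-monoid Letter) using (solve; _⊕_; _⊜_)

replicate-∷ʳ : ∀ {A : Set} (x : A) n → replicate (suc n) x ≡ replicate n x ∷ʳ x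
replicate-∷ʳ x zero    = refl
replicate-∷ʳ x (suc n) = cong (x ∷_) (replicate-∷ʳ x n)

replicate-++ : ∀ {A : Set} (x : A) m n → replicate m x ++ replicate n x ≡ replicate (m + n) x
replicate-++ x zero    n = refl
replicate-++ x (suc m) n = cong (x ∷_) (replicate-++ x m n)

reverse-replicate : ∀ {A : Set} (x : A) n → reverse (replicate n x) ≡ replicate n x
reverse-replicate x zero    = refl
reverse-replicate x (suc n) = begin
  reverse (x ∷ replicate n x)   ≡⟨ unfold-reverse x (replicate n x) ⟩
  reverse (replicate n x) ∷ʳ x  ≡⟨ cong (_∷ʳ x) (reverse-replicate x n) ⟩
  replicate n x ∷ʳ x            ≡⟨ replicate-∷ʳ x n ⟨
  replicate (suc n) x           ∎
  where open ≡-Reasoning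

take-length-++ : ∀ {A : Set} (xs ys : List A) → take (length xs) (xs ++ ys) ≡ xs
take-length-++ []       ys = refl
take-length-++ (x ∷ xs) ys = cong (x ∷_) (take-length-++ xs ys)

take-++ˡ : ∀ {A : Set} n (xs ys : List A) → n ≤ length xs → take n (xs ++ ys) ≡ take n xs
take-++ˡ zero    xs       ys _         = refl
take-++ˡ (suc n) (x ∷ xs) ys (s≤s n≤) = cong (x ∷_) (take-++ˡ n xs ys n≤)

++-injective : ∀ {A : Set} (xs xs′ : List A) {ys ys′} → length xs ≡ length xs′ → xs ++ ys ≡ xs′ ++ ys′ → xs ≡ xs′ × ys ≡ ys′
++-injective []       []         _   e = refl , e
++-injective (x ∷ xs) (x′ ∷ xs′) len e
  with refl , e′ ← ∷-injective e
  with refl , e″ ← ++-injective xs xs′ (suc-injective len) e′ = refl , e″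

∷-as-∷ʳ : ∀ {A : Set} (x : A) xs → ∃₂ λ ys y → x ∷ xs ≡ ys ∷ʳ y
∷-as-∷ʳ x []        = [] , x , refl
∷-as-∷ʳ x (x′ ∷ xs) with ys , y , e ← ∷-as-∷ʳ x′ xs = x ∷ ys , y , cong (x ∷_) e

length≡suc⇒∷ʳ : ∀ {A : Set} (v : List A) {n} → length v ≡ suc n → ∃₂ λ w x → v ≡ w ∷ʳ x
length≡suc⇒∷ʳ (x₀ ∷ v) _ = ∷-as-∷ʳ x₀ v

length-∷ʳ : ∀ {A : Set} (w : List A) x → length (w ∷ʳ x) ≡ suc (length w)
length-∷ʳ w x = trans (length-++ w) (+-comm (length w) 1)

length-++-< : ∀ {A : Set} (X y r s : List A) → length X ≤ length y → length r < length s → length (X ++ r) < length (y ++ s)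
length-++-< X y r s X≤y r<s = begin-strict
  length (X ++ r)      ≡⟨ length-++ X ⟩
  length X + length r  <⟨ +-mono-≤-< X≤y r<s ⟩
  length y + length s  ≡⟨ length-++ y ⟨
  length (y ++ s)      ∎
  where open ≤-Reasoning

applyUpTo-+ : ∀ {A : Set} (f : ℕ → A) m n → applyUpTo f (m + n) ≡ applyUpTo f m ++ applyUpTo (λ j → f (m + j)) n
applyUpTo-+ f zero    n = refl
applyUpTo-+ f (suc m) n = cong (f 0 ∷_) (applyUpTo-+ (f ∘ suc) m n)

length-filter-upTo : ∀ {P : ℕ → Set} (P? : ∀ x → Dec (P x)) {v N} →
                     (∀ {x} → x < v → P x) → (∀ {x} → v ≤ x → ¬ P x) → v ≤ N → length (filter P? (upTo N)) ≡ v
length-filter-upTo {P} P? {v} {N} below above v≤N = begin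
  length (filter P? (upTo N))                                  ≡⟨ cong (length ∘ filter P? ∘ upTo) (m+[n∸m]≡n v≤N) ⟨
  length (filter P? (applyUpTo id (v + d)))                    ≡⟨ cong (length ∘ filter P?) (applyUpTo-+ id v d) ⟩
  length (filter P? (upTo v ++ applyUpTo (v +_) d))            ≡⟨ cong length (filter-++ P? (upTo v) _) ⟩
  length (filter P? (upTo v) ++ filter P? (applyUpTo (v +_) d)) ≡⟨ cong₂ (λ xs ys → length (xs ++ ys)) (filter-all P? all-below) (filter-none P? none-above) ⟩
  length (upTo v ++ [])                                        ≡⟨ cong length (++-identityʳ (upTo v)) ⟩
  length (upTo v)                                              ≡⟨ length-upTo v ⟩
  v                                                            ∎
  where
  open ≡-Reasoning
  d : ℕ
  d = N ∸ v
  all-below : All P (upTo v)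
  all-below = All.applyUpTo⁺₁ id v below
  none-above : All (¬_ ∘ P) (applyUpTo (v +_) d)
  none-above = All.applyUpTo⁺₂ (v +_) d (λ i → above (m≤m+n v i))

map⁺-on : ∀ {A B : Set} {P : A → Set} {f : A → B} {xs} → (∀ {x y} → P x → P y → f x ≡ f y → x ≡ y) →
          All P xs → Unique xs → Unique (map f xs)
map⁺-on f-inj []         []          = []
map⁺-on f-inj (px ∷ pxs) (x∉xs ∷ uxs) =
  All.map⁺ (All.zipWith (λ (py , x≢y) e → x≢y (f-inj px py e)) (pxs , x∉xs)) ∷ map⁺-on f-inj pxs uxs

-- Total indexing (0 past the end), which avoids transporting Fin indices along list equations.
_!_ : List ℕ → ℕ → ℕ
[]       ! _     = 0
(x ∷ xs) ! zero  = x
(x ∷ xs) ! suc n = xs ! n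

lookup-fromℕ< : ∀ xs {n} (n< : n < length xs) → lookup xs (fromℕ< n<) ≡ xs ! n
lookup-fromℕ< (x ∷ xs) {zero}  _         = refl
lookup-fromℕ< (x ∷ xs) {suc n} (s≤s n<) = lookup-fromℕ< xs n<

!-++ˡ : ∀ xs ys {n} → n < length xs → (xs ++ ys) ! n ≡ xs ! n
!-++ˡ (x ∷ xs) ys {zero}  _         = refl
!-++ˡ (x ∷ xs) ys {suc n} (s≤s n<) = !-++ˡ xs ys n<

!-++ʳ : ∀ xs ys o → (xs ++ ys) ! (length xs + o) ≡ ys ! o
!-++ʳ []       ys o = refl
!-++ʳ (x ∷ xs) ys o = !-++ʳ xs ys o

!-applyUpTo : ∀ f m {o} → o < m → applyUpTo f m ! o ≡ f o
!-applyUpTo f (suc m) {zero}  _         = refl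
!-applyUpTo f (suc m) {suc o} (s≤s o<) = !-applyUpTo (f ∘ suc) m o<

-- Right extensions in a factorial language over {a, b}

_≟ₗ_ : (x y : Letter) → Dec (x ≡ y)
a ≟ₗ a = yes refl
b ≟ₗ b = yes refl
a ≟ₗ b = no λ ()
b ≟ₗ a = no λ ()

_∈ʷ?_ : (w : Word) (L : List Word) → Dec (w ∈ L)
_∈ʷ?_ = _∈?_ (≡-dec _≟ₗ_)

length-filter-∈ʷ : ∀ {L R} → Unique L → Unique R → (∀ {w} → w ∈ R → w ∈ L) → length (filter (_∈ʷ? R) L) ≡ length R
length-filter-∈ʷ {L} {R} uL uR R⊆L = ↭-length (∼bag⇒↭ (unique∧set⇒bag (Unique.filter⁺ (_∈ʷ? R) uL) uR (mk⇔ to from)))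
  where
  to : ∀ {w} → w ∈ filter (_∈ʷ? R) L → w ∈ R
  to w∈ = proj₂ (∈-filter⁻ (_∈ʷ? R) {xs = L} w∈)
  from : ∀ {w} → w ∈ R → w ∈ filter (_∈ʷ? R) L
  from w∈R = ∈-filter⁺ (_∈ʷ? R) (R⊆L w∈R) w∈R

Enumerates : (Word → Set) → ℕ → List Word → Set
Enumerates P n L = Unique L × All (λ w → length w ≡ n × P w) L × (∀ w → length w ≡ n → P w → w ∈ L)

enumerates-⇔ : ∀ {P Q : Word → Set} {n L} → (∀ {w} → P w → Q w) → (∀ {w} → Q w → P w) → Enumerates P n L → Enumerates Q n L
enumerates-⇔ P⇒Q Q⇒P (unique , sound , complete) = unique , All.map (×-map id P⇒Q) sound , λ w len q → complete w len (Q⇒P q)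

RightSpecial : (Word → Set) → Word → Set
RightSpecial P w = P (w ∷ʳ a) × P (w ∷ʳ b)

∷ʳ-≢ : ∀ {w w′ : Word} x x′ → w ≢ w′ → w ∷ʳ x ≢ w′ ∷ʳ x′
∷ʳ-≢ {w} {w′} x x′ w≢w′ e = w≢w′ (∷ʳ-injectiveˡ w w′ e)

distinct-extensions⇒rightSpecial : ∀ (P : Word → Set) {w x y} → x ≢ y → P (w ∷ʳ x) → P (w ∷ʳ y) → RightSpecial P w
distinct-extensions⇒rightSpecial _ {x = a} {a} x≢y _  _  = ⊥-elim (x≢y refl)
distinct-extensions⇒rightSpecial _ {x = a} {b} _   pa pb = pa , pb
distinct-extensions⇒rightSpecial _ {x = b} {a} _   pb pa = pa , pb
distinct-extensions⇒rightSpecial _ {x = b} {b} x≢y _  _  = ⊥-elim (x≢y refl)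

module RightExtensions (P : Word → Set) (P-extend : ∀ {w} → P w → ∃[ x ] P (w ∷ʳ x))
                       (R : List Word) (R-sound : ∀ {w} → w ∈ R → RightSpecial P w) where

  extensions : (L : List Word) → All P L → List Word
  extensions []      []       = []
  extensions (w ∷ L) (p ∷ ps) with w ∈ʷ? R
  ... | yes _ = (w ∷ʳ a) ∷ (w ∷ʳ b) ∷ extensions L ps
  ... | no  _ = (w ∷ʳ proj₁ (P-extend p)) ∷ extensions L ps

  length-extensions : ∀ L ps → length (extensions L ps) ≡ length L + length (filter (_∈ʷ? R) L)
  length-extensions []      []       = refl
  length-extensions (w ∷ L) (p ∷ ps) with w ∈ʷ? R
  ... | yes _ = cong suc (trans (cong suc (length-extensions L ps)) (sym (+-suc (length L) _)))
  ... | no  _ = cong suc (length-extensions L ps)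

  extensions-sound : ∀ L ps → All P (extensions L ps)
  extensions-sound []      []       = []
  extensions-sound (w ∷ L) (p ∷ ps) with w ∈ʷ? R
  ... | yes w∈R = proj₁ (R-sound w∈R) ∷ proj₂ (R-sound w∈R) ∷ extensions-sound L ps
  ... | no  _   = proj₂ (P-extend p) ∷ extensions-sound L ps

  ∈-extensions⁻ : ∀ {v} L ps → v ∈ extensions L ps → ∃₂ λ w x → w ∈ L × v ≡ w ∷ʳ x
  ∈-extensions⁻ (w ∷ L) (p ∷ ps) v∈ with w ∈ʷ? R | v∈
  ... | yes _ | here refl         = w , a , here refl , refl
  ... | yes _ | there (here refl) = w , b , here refl , refl
  ... | yes _ | there (there v∈′) with w′ , x , w′∈ , e ← ∈-extensions⁻ L ps v∈′ = w′ , x , there w′∈ , e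
  ... | no  _ | here refl         = w , _ , here refl , refl
  ... | no  _ | there v∈′         with w′ , x , w′∈ , e ← ∈-extensions⁻ L ps v∈′ = w′ , x , there w′∈ , e

  ∈-extensions⁺ : ∀ {w x} L ps → w ∈ L → P (w ∷ʳ x) → (RightSpecial P w → w ∈ R) → w ∷ʳ x ∈ extensions L ps
  ∈-extensions⁺ {x = x} (w ∷ L) (p ∷ ps) (here refl) px rs⇒∈R with w ∈ʷ? R | x
  ... | yes _ | a = here refl
  ... | yes _ | b = there (here refl)
  ... | no w∉R | x with x ≟ₗ proj₁ (P-extend p)
  ...   | yes refl = here refl
  ...   | no  x≢c  = ⊥-elim (w∉R (rs⇒∈R (distinct-extensions⇒rightSpecial P x≢c px (proj₂ (P-extend p)))))
  ∈-extensions⁺ (w′ ∷ L) (p ∷ ps) (there w∈) px rs⇒∈R with w′ ∈ʷ? R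
  ... | yes _ = there (there (∈-extensions⁺ L ps w∈ px rs⇒∈R))
  ... | no  _ = there (∈-extensions⁺ L ps w∈ px rs⇒∈R)

  extensions-fresh : ∀ {w} x L ps → All (w ≢_) L → All (w ∷ʳ x ≢_) (extensions L ps)
  extensions-fresh x []       []       []           = []
  extensions-fresh x (w′ ∷ L) (p ∷ ps) (w≢w′ ∷ w∉L) with w′ ∈ʷ? R
  ... | yes _ = ∷ʳ-≢ x a w≢w′ ∷ ∷ʳ-≢ x b w≢w′ ∷ extensions-fresh x L ps w∉L
  ... | no  _ = ∷ʳ-≢ x _ w≢w′ ∷ extensions-fresh x L ps w∉L

  extensions-unique : ∀ L ps → Unique L → Unique (extensions L ps)
  extensions-unique []      []       []         = []
  extensions-unique (w ∷ L) (p ∷ ps) (w∉L ∷ uL) with w ∈ʷ? R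
  ... | yes _ = (((λ ()) ∘ ∷ʳ-injectiveʳ w w) ∷ extensions-fresh a L ps w∉L)
              ∷ extensions-fresh b L ps w∉L ∷ extensions-unique L ps uL
  ... | no  _ = extensions-fresh _ L ps w∉L ∷ extensions-unique L ps uL

-- A word of length n has two one-letter extensions if it is right special and one otherwise.
enumerates-suc : ∀ {P n L R} → (∀ {w x} → P (w ∷ʳ x) → P w) → (∀ {w} → P w → ∃[ x ] P (w ∷ʳ x)) →
                 Enumerates P n L → Enumerates (RightSpecial P) n R →
                 ∃[ L′ ] Enumerates P (suc n) L′ × length L′ ≡ length L + length R
enumerates-suc {P} {n} {L} {R} P-init P-extend (uL , allL , completeL) (uR , allR , completeR) =
  extensions L ps , (extensions-unique L ps uL , sound , complete) ,
  trans (length-extensions L ps) (cong (length L +_) (length-filter-∈ʷ uL uR R⊆L))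
  where
  open RightExtensions P P-extend R (proj₂ ∘ All.lookup allR)
  ps : All P L
  ps = All.map proj₂ allL
  R⊆L : ∀ {w} → w ∈ R → w ∈ L
  R⊆L {w} w∈R with n≡ , pa , _ ← All.lookup allR w∈R = completeL w n≡ (P-init pa)
  length-extension : ∀ {v} → v ∈ extensions L ps → length v ≡ suc n
  length-extension v∈ with w , x , w∈ , refl ← ∈-extensions⁻ L ps v∈ = trans (length-∷ʳ w x) (cong suc (proj₁ (All.lookup allL w∈)))
  sound : All (λ v → length v ≡ suc n × P v) (extensions L ps)
  sound = All.tabulate λ v∈ → length-extension v∈ , All.lookup (extensions-sound L ps) v∈
  complete : ∀ v → length v ≡ suc n → P v → v ∈ extensions L ps
  complete v len pv with w , x , refl ← length≡suc⇒∷ʳ v len =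
    ∈-extensions⁺ L ps (completeL w n≡ (P-init pv)) pv (completeR w n≡)
    where
    n≡ : length w ≡ n
    n≡ = suc-injective (trans (sym (length-∷ʳ w x)) len)

-- The morphism h and the words u k = hᵏ(a)

h-++ : ∀ x y → h (x ++ y) ≡ h x ++ h y
h-++ = concatMap-++ hL

h^-++ : ∀ k x y → h^ k (x ++ y) ≡ h^ k x ++ h^ k y
h^-++ zero    x y = refl
h^-++ (suc k) x y = trans (cong h (h^-++ k x y)) (h-++ (h^ k x) (h^ k y))

h-replicate-b : ∀ t → h (replicate t b) ≡ replicate t b
h-replicate-b zero    = refl
h-replicate-b (suc t) = cong (b ∷_) (h-replicate-b t)

h^-b : ∀ k → h^ k [ b ] ≡ [ b ]
h^-b zero    = refl
h^-b (suc k) = cong h (h^-b k)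

h-h^-comm : ∀ k w → h (h^ k w) ≡ h^ k (h w)
h-h^-comm zero    w = refl
h-h^-comm (suc k) w = cong h (h-h^-comm k w)

h-injective : ∀ X Y → h X ≡ h Y → X ≡ Y
h-injective []      []      _ = refl
h-injective (a ∷ X) (a ∷ Y) e = cong (a ∷_) (h-injective X Y (∷-injectiveʳ (∷-injectiveʳ (∷-injectiveʳ e))))
h-injective (b ∷ X) (b ∷ Y) e = cong (b ∷_) (h-injective X Y (∷-injectiveʳ e))
h-injective []      (a ∷ Y) ()
h-injective []      (b ∷ Y) ()
h-injective (a ∷ X) []      ()
h-injective (b ∷ X) []      ()
h-injective (a ∷ X) (b ∷ Y) ()
h-injective (b ∷ X) (a ∷ Y) ()

h≡b∷h⇒ : ∀ Y Y′ → h Y ≡ b ∷ h Y′ → Y ≡ b ∷ Y′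
h≡b∷h⇒ (b ∷ Y) Y′ e = cong (b ∷_) (h-injective Y Y′ (∷-injectiveʳ e))
h≡b∷h⇒ []      Y′ ()
h≡b∷h⇒ (a ∷ Y) Y′ ()

length-≤-length-h : ∀ X → length X ≤ length (h X)
length-≤-length-h []      = z≤n
length-≤-length-h (a ∷ X) = s≤s (m≤n⇒m≤o+n 2 (length-≤-length-h X))
length-≤-length-h (b ∷ X) = s≤s (length-≤-length-h X)

h-ends-with-b : ∀ x X → ∃[ q ] h (x ∷ X) ≡ q ∷ʳ b
h-ends-with-b a []      = a ∷ a ∷ [] , refl
h-ends-with-b b []      = [] , refl
h-ends-with-b x (y ∷ X) with q , e ← h-ends-with-b y X =
  hL x ++ q , trans (cong (hL x ++_) e) (sym (++-assoc (hL x) q [ b ]))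

u : ℕ → Word
u k = h^ k [ a ]

u-suc : ∀ k → u (suc k) ≡ u k ++ u k ++ [ b ]
u-suc k = begin
  h (h^ k [ a ])                 ≡⟨ h-h^-comm k [ a ] ⟩
  h^ k ([ a ] ++ [ a ] ++ [ b ]) ≡⟨ h^-++ k [ a ] _ ⟩
  u k ++ h^ k ([ a ] ++ [ b ])   ≡⟨ cong (u k ++_) (h^-++ k [ a ] [ b ]) ⟩
  u k ++ u k ++ h^ k [ b ]       ≡⟨ cong (λ v → u k ++ u k ++ v) (h^-b k) ⟩
  u k ++ u k ++ [ b ]            ∎
  where open ≡-Reasoning

u-starts-with-a : ∀ k → ∃[ r ] u k ≡ a ∷ r
u-starts-with-a zero    = [] , refl
u-starts-with-a (suc k) with r , e ← u-starts-with-a k =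
  r ++ u k ++ [ b ] , trans (u-suc k) (cong (_++ u k ++ [ b ]) e)

u-prefix : ∀ {K m} → K ≤ m → ∃[ r ] u m ≡ u K ++ r
u-prefix {K} {m} K≤m = subst (λ m → ∃[ r ] u m ≡ u K ++ r) (m+[n∸m]≡n K≤m) (go (m ∸ K))
  where
  go : ∀ d → ∃[ r ] u (K + d) ≡ u K ++ r
  go zero    = [] , trans (cong u (+-identityʳ K)) (sym (++-identityʳ (u K)))
  go (suc d) with r , e ← go d = r ++ u (K + d) ++ [ b ] , (begin
    u (K + suc d)                    ≡⟨ cong u (+-suc K d) ⟩
    u (suc (K + d))                  ≡⟨ u-suc (K + d) ⟩
    u (K + d) ++ u (K + d) ++ [ b ]  ≡⟨ cong (_++ _) e ⟩
    (u K ++ r) ++ u (K + d) ++ [ b ] ≡⟨ ++-assoc (u K) r _ ⟩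
    u K ++ r ++ u (K + d) ++ [ b ] ∎)
    where open ≡-Reasoning

n≤length-u : ∀ n → n ≤ length (u n)
n≤length-u zero    = z≤n
n≤length-u (suc n) = begin
  suc n                           ≤⟨ s≤s (n≤length-u n) ⟩
  suc L                           ≡⟨ +-comm 1 L ⟩
  L + 1                           ≤⟨ m≤n+m (L + 1) L ⟩
  L + (L + 1)                     ≡⟨ cong (L +_) (length-++ (u n)) ⟨
  L + length (u n ++ [ b ])       ≡⟨ length-++ (u n) ⟨
  length (u n ++ u n ++ [ b ])    ≡⟨ cong length (u-suc n) ⟨
  length (u (suc n))              ∎
  where
  open ≤-Reasoning
  L : ℕ
  L = length (u n)

suc-length-u : ∀ k → suc (length (u k)) ≡ 2 ^ suc k
suc-length-u zero    = refl
suc-length-u (suc k) = begin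
  suc (length (u (suc k)))          ≡⟨ cong (suc ∘ length) (u-suc k) ⟩
  suc (length (u k ++ u k ++ [ b ])) ≡⟨ cong suc (trans (length-++ (u k)) (cong (L +_) (length-++ (u k)))) ⟩
  suc (L + (L + 1))                  ≡⟨ cong (λ v → suc (L + v)) (trans (+-comm L 1) (sym (+-identityʳ (suc L)))) ⟩
  2 * suc L                          ≡⟨ cong (2 *_) (suc-length-u k) ⟩
  2 ^ suc (suc k)                    ∎
  where
  open ≡-Reasoning
  L : ℕ
  L = length (u k)

reverse-u-suc : ∀ K → reverse (u (suc K)) ≡ b ∷ reverse (u K) ++ reverse (u K)
reverse-u-suc K = begin
  reverse (u (suc K))                           ≡⟨ cong reverse (u-suc K) ⟩
  reverse (u K ++ u K ++ [ b ])                 ≡⟨ reverse-++ (u K) _ ⟩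
  reverse (u K ++ [ b ]) ++ reverse (u K)       ≡⟨ cong (_++ reverse (u K)) (reverse-++ (u K) [ b ]) ⟩
  (b ∷ reverse (u K)) ++ reverse (u K)          ∎
  where open ≡-Reasoning

bᴷ++u≡reverse-u++bᴷ : ∀ K → replicate K b ++ u K ≡ reverse (u K) ++ replicate K b
bᴷ++u≡reverse-u++bᴷ zero    = refl
bᴷ++u≡reverse-u++bᴷ (suc K) = begin
  b ∷ bᴷ ++ u (suc K)                  ≡⟨ cong (λ v → b ∷ bᴷ ++ v) (u-suc K) ⟩
  b ∷ bᴷ ++ uᴷ ++ uᴷ ++ [ b ]           ≡⟨ cong (b ∷_) (++-assoc bᴷ uᴷ _) ⟨
  b ∷ (bᴷ ++ uᴷ) ++ uᴷ ++ [ b ]         ≡⟨ cong (λ v → b ∷ v ++ uᴷ ++ [ b ]) (bᴷ++u≡reverse-u++bᴷ K) ⟩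
  b ∷ (ruᴷ ++ bᴷ) ++ uᴷ ++ [ b ]        ≡⟨ cong (b ∷_) (solve 4 (λ X R U B → (X ⊕ R) ⊕ (U ⊕ B) ⊜ X ⊕ ((R ⊕ U) ⊕ B)) refl ruᴷ bᴷ uᴷ [ b ]) ⟩
  b ∷ ruᴷ ++ (bᴷ ++ uᴷ) ++ [ b ]        ≡⟨ cong (λ v → b ∷ ruᴷ ++ v ++ [ b ]) (bᴷ++u≡reverse-u++bᴷ K) ⟩
  b ∷ ruᴷ ++ (ruᴷ ++ bᴷ) ++ [ b ]       ≡⟨ cong (b ∷_) (solve 3 (λ X R B → X ⊕ ((X ⊕ R) ⊕ B) ⊜ (X ⊕ X) ⊕ (R ⊕ B)) refl ruᴷ bᴷ [ b ]) ⟩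
  (b ∷ ruᴷ ++ ruᴷ) ++ bᴷ ∷ʳ b           ≡⟨ cong₂ _++_ (reverse-u-suc K) (replicate-∷ʳ b K) ⟨
  reverse (u (suc K)) ++ replicate (suc K) b ∎
  where
  open ≡-Reasoning
  bᴷ uᴷ ruᴷ : Word
  bᴷ = replicate K b
  uᴷ = u K
  ruᴷ = reverse (u K)

_InfixOf_ : Word → Word → Set
v InfixOf U = ∃₂ λ P Q → U ≡ P ++ v ++ Q

Factor : Word → Set
Factor v = ∃[ m ] v InfixOf u m

infixOf-inner : ∀ x v y {U} → (x ++ v ++ y) InfixOf U → v InfixOf U
infixOf-inner x v y (P , Q , e) = P ++ x , y ++ Q ,
  trans e (solve 5 (λ P x v y Q → P ⊕ ((x ⊕ (v ⊕ y)) ⊕ Q) ⊜ (P ⊕ x) ⊕ (v ⊕ (y ⊕ Q))) refl P x v y Q)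

infixOf-h : ∀ {v U} → v InfixOf U → h v InfixOf h U
infixOf-h {v} (P , Q , refl) = h P , h Q , trans (h-++ P (v ++ Q)) (cong (h P ++_) (h-++ v Q))

infixOf-u-suc : ∀ {v} m → v InfixOf u m → v InfixOf u (suc m)
infixOf-u-suc {v} m (P , Q , e) = P , Q ++ u m ++ [ b ] ,
  trans (u-suc m) (trans (cong (_++ u m ++ [ b ]) e)
    (solve 4 (λ P v Q W → (P ⊕ (v ⊕ Q)) ⊕ W ⊜ P ⊕ (v ⊕ (Q ⊕ W))) refl P v Q (u m ++ [ b ])))

factor-inner : ∀ x v y → Factor (x ++ v ++ y) → Factor v
factor-inner x v y (m , i) = m , infixOf-inner x v y i

factor-prefix : ∀ v y → Factor (v ++ y) → Factor v
factor-prefix = factor-inner []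

factor-suffix : ∀ x v → Factor (x ++ v) → Factor v
factor-suffix x v p = factor-inner x v [] (subst Factor (cong (x ++_) (sym (++-identityʳ v))) p)

factor-∷ʳ-assoc : ∀ y v x → Factor ((y ++ v) ∷ʳ x) → Factor (y ++ v ∷ʳ x)
factor-∷ʳ-assoc y v x = subst Factor (++-assoc y v [ x ])

factor-h : ∀ {v} → Factor v → Factor (h v)
factor-h (m , i) = suc m , infixOf-h i

-- The second copy of u m in u (m + 1) is preceded by the nonempty word u m.
factor-extendˡ : ∀ {v} → Factor v → ∃[ x ] Factor (x ∷ v)
factor-extendˡ {v} (m , P , Q , e)
  with r , er ← u-starts-with-a m
  with ys , y , ey ← ∷-as-∷ʳ a (r ++ P) = y , suc m , ys , Q ++ [ b ] , (begin
    u (suc m)                                ≡⟨ u-suc m ⟩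
    u m ++ u m ++ [ b ]                      ≡⟨ cong₂ (λ s t → s ++ t ++ [ b ]) er e ⟩
    (a ∷ r) ++ (P ++ v ++ Q) ++ [ b ]        ≡⟨ cong (a ∷_) (solve 5 (λ r P v Q B → r ⊕ ((P ⊕ (v ⊕ Q)) ⊕ B) ⊜ (r ⊕ P) ⊕ (v ⊕ (Q ⊕ B))) refl r P v Q [ b ]) ⟩
    (a ∷ r ++ P) ++ v ++ Q ++ [ b ]          ≡⟨ cong (_++ v ++ Q ++ [ b ]) ey ⟩
    (ys ∷ʳ y) ++ v ++ Q ++ [ b ]             ≡⟨ ++-assoc ys [ y ] _ ⟩
    ys ++ (y ∷ v) ++ Q ++ [ b ]              ∎)
  where open ≡-Reasoning

factor-b∷h : ∀ x v → Factor (x ∷ v) → Factor (b ∷ h v)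
factor-b∷h x v p with q , e ← h-ends-with-b x [] =
  factor-suffix q (b ∷ h v) (subst Factor eq (factor-h p))
  where
  eq : h (x ∷ v) ≡ q ++ b ∷ h v
  eq = trans (cong (_++ h v) (trans (sym (++-identityʳ (hL x))) e)) (++-assoc q [ b ] (h v))

-- Desubstitution

data HCut (U p r : Word) : Set where
  between  : ∀ U₁ U₂ → U ≡ U₁ ++ U₂ → p ≡ h U₁ → r ≡ h U₂ → HCut U p r
  after-a  : ∀ U₁ U₂ → U ≡ U₁ ++ a ∷ U₂ → p ≡ h U₁ ++ a ∷ [] → r ≡ a ∷ b ∷ h U₂ → HCut U p r
  after-aa : ∀ U₁ U₂ → U ≡ U₁ ++ a ∷ U₂ → p ≡ h U₁ ++ a ∷ a ∷ [] → r ≡ b ∷ h U₂ → HCut U p r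

hCut-∷ : ∀ x {U p r} → HCut U p r → HCut (x ∷ U) (hL x ++ p) r
hCut-∷ x (between U₁ U₂ e₁ e₂ e₃) = between (x ∷ U₁) U₂ (cong (x ∷_) e₁) (cong (hL x ++_) e₂) e₃
hCut-∷ x (after-a U₁ U₂ e₁ e₂ e₃) =
  after-a (x ∷ U₁) U₂ (cong (x ∷_) e₁) (trans (cong (hL x ++_) e₂) (sym (++-assoc (hL x) (h U₁) _))) e₃
hCut-∷ x (after-aa U₁ U₂ e₁ e₂ e₃) =
  after-aa (x ∷ U₁) U₂ (cong (x ∷_) e₁) (trans (cong (hL x ++_) e₂) (sym (++-assoc (hL x) (h U₁) _))) e₃

hCut : ∀ U p r → h U ≡ p ++ r → HCut U p r
hCut U       []          r e = between [] U refl refl (sym e)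
hCut (b ∷ U) (x ∷ p)     r e with refl , e′ ← ∷-injective e = hCut-∷ b (hCut U p r e′)
hCut (a ∷ U) (x ∷ [])    r e with refl , e′ ← ∷-injective e = after-a [] U refl refl (sym e′)
hCut (a ∷ U) (x ∷ y ∷ []) r e
  with refl , e′ ← ∷-injective e
  with refl , e″ ← ∷-injective e′ = after-aa [] U refl refl (sym e″)
hCut (a ∷ U) (x ∷ y ∷ y′ ∷ p) r e
  with refl , e′ ← ∷-injective e
  with refl , e″ ← ∷-injective e′
  with refl , e‴ ← ∷-injective e″ = hCut-∷ a (hCut U p r e‴)

h-cancelˡ : ∀ X U r → h U ≡ h X ++ r → ∃[ U′ ] U ≡ X ++ U′ × h U′ ≡ r
h-cancelˡ []      U       r e = U , refl , e
h-cancelˡ (a ∷ X) (a ∷ U) r e with U′ , e₁ , e₂ ← h-cancelˡ X U r (∷-injectiveʳ (∷-injectiveʳ (∷-injectiveʳ e))) =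
  U′ , cong (a ∷_) e₁ , e₂
h-cancelˡ (b ∷ X) (b ∷ U) r e with U′ , e₁ , e₂ ← h-cancelˡ X U r (∷-injectiveʳ e) =
  U′ , cong (b ∷_) e₁ , e₂
h-cancelˡ (a ∷ X) []      r ()
h-cancelˡ (a ∷ X) (b ∷ U) r ()
h-cancelˡ (b ∷ X) []      r ()
h-cancelˡ (b ∷ X) (a ∷ U) r ()

h≡∷⇒ : ∀ c U r → h U ≡ c ∷ r → ∃[ U′ ] U ≡ c ∷ U′
h≡∷⇒ a (a ∷ U) r e = U , refl
h≡∷⇒ b (b ∷ U) r e = U , refl
h≡∷⇒ c []      r ()
h≡∷⇒ a (b ∷ U) r ()
h≡∷⇒ b (a ∷ U) r ()

h≢ab∷ : ∀ Y X → h Y ≢ a ∷ b ∷ X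
h≢ab∷ []      X ()
h≢ab∷ (a ∷ Y) X ()
h≢ab∷ (b ∷ Y) X ()

h≢-++aaa++ : ∀ U P Q → h U ≢ P ++ a ∷ a ∷ a ∷ Q
h≢-++aaa++ U P Q e with hCut U P (a ∷ a ∷ a ∷ Q) e
... | between _ (a ∷ U₂) _ _ ()
... | between _ (b ∷ U₂) _ _ ()
... | between _ []       _ _ ()
... | after-a  _ _ _ _ ()
... | after-aa _ _ _ _ ()

h≢-++bab++ : ∀ U P Q → h U ≢ P ++ b ∷ a ∷ b ∷ Q
h≢-++bab++ U P Q e with hCut U P (b ∷ a ∷ b ∷ Q) e
... | between _ (b ∷ a ∷ U₂) _ _ ()
... | between _ (b ∷ b ∷ U₂) _ _ ()
... | between _ (b ∷ [])     _ _ ()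
... | between _ (a ∷ U₂)     _ _ ()
... | between _ []           _ _ ()
... | after-a  _ _ _ _ ()
... | after-aa _ (a ∷ U₂) _ _ ()
... | after-aa _ (b ∷ U₂) _ _ ()
... | after-aa _ []       _ _ ()

aaa-not-factor : ¬ Factor (a ∷ a ∷ a ∷ [])
aaa-not-factor (zero  , []        , Q , ())
aaa-not-factor (zero  , _ ∷ []    , Q , ())
aaa-not-factor (zero  , _ ∷ _ ∷ _ , Q , ())
aaa-not-factor (suc m , P         , Q , e) = h≢-++aaa++ (u m) P Q e

bab-not-factor : ¬ Factor (b ∷ a ∷ b ∷ [])
bab-not-factor (zero  , []        , Q , ())
bab-not-factor (zero  , _ ∷ []    , Q , ())
bab-not-factor (zero  , _ ∷ _ ∷ _ , Q , ())
bab-not-factor (suc m , P         , Q , e) = h≢-++bab++ (u m) P Q e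

-- Before the block h(a) = aab, y is h Y, or h Y preceded by the last one or two letters of a block aab.
data Preimage (F : Word → Set) (y W : Word) : Set where
  whole  : ∀ Y → y ≡ h Y         → F (Y ++ W)     → Preimage F y W
  cut-b  : ∀ Y → y ≡ b ∷ h Y     → F (a ∷ Y ++ W) → Preimage F y W
  cut-ab : ∀ Y → y ≡ a ∷ b ∷ h Y → F (a ∷ Y ++ W) → Preimage F y W

abᵗc : ℕ → Letter → Word
abᵗc t c = a ∷ replicate t b ++ [ c ]

infixOf-desubstitute : ∀ U y t c → (y ++ a ∷ a ∷ b ∷ replicate t b ++ [ c ]) InfixOf h U →
                       Preimage (_InfixOf U) y (abᵗc t c)
infixOf-desubstitute U y t c (P , Q , e) = cut-outer (hCut U (P ++ y) _ e′)
  where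
  bᵗ : Word
  bᵗ = replicate t b
  e′ : h U ≡ (P ++ y) ++ a ∷ a ∷ b ∷ bᵗ ++ c ∷ Q
  e′ = trans e (solve 6 (λ P y A B C Q → P ⊕ ((y ⊕ (A ⊕ (B ⊕ C))) ⊕ Q) ⊜ (P ⊕ y) ⊕ (A ⊕ (B ⊕ (C ⊕ Q))))
                        refl P y (a ∷ a ∷ b ∷ []) bᵗ [ c ] Q)
  h-abᵗ : h (a ∷ bᵗ) ≡ a ∷ a ∷ b ∷ bᵗ
  h-abᵗ = cong (λ v → a ∷ a ∷ b ∷ v) (h-replicate-b t)
  infix-at : ∀ U₀ Y′ U₄ → (Y′ ++ abᵗc t c) InfixOf ((U₀ ++ Y′) ++ a ∷ bᵗ ++ c ∷ U₄)
  infix-at U₀ Y′ U₄ = U₀ , U₄ ,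
    solve 5 (λ U Y A C V → (U ⊕ Y) ⊕ (A ⊕ (C ⊕ V)) ⊜ U ⊕ ((Y ⊕ (A ⊕ C)) ⊕ V)) refl U₀ Y′ (a ∷ bᵗ) [ c ] U₄
  cut-outer : HCut U (P ++ y) (a ∷ a ∷ b ∷ bᵗ ++ c ∷ Q) → Preimage (_InfixOf U) y (abᵗc t c)
  cut-outer (between U₁ U₂ refl e₁ e₂)
    with U₃ , refl , e₃ ← h-cancelˡ (a ∷ bᵗ) U₂ (c ∷ Q) (trans (sym e₂) (cong (_++ c ∷ Q) (sym h-abᵗ)))
    with U₄ , refl      ← h≡∷⇒ c U₃ Q e₃
    with hCut U₁ P y (sym e₁)
  ... | between  U₀ Y refl _ ey = whole  Y ey (infix-at U₀ Y U₄)
  ... | after-a  U₀ Y refl _ ey = cut-ab Y ey (infix-at U₀ (a ∷ Y) U₄)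
  ... | after-aa U₀ Y refl _ ey = cut-b  Y ey (infix-at U₀ (a ∷ Y) U₄)
  cut-outer (after-a  _ _ _ _ ())
  cut-outer (after-aa _ _ _ _ ())

factor-desubstitute : ∀ y t c → Factor (y ++ a ∷ a ∷ b ∷ replicate t b ++ [ c ]) → Preimage Factor y (abᵗc t c)
factor-desubstitute y t c (m , i) with infixOf-desubstitute (u m) y t c (infixOf-u-suc m i)
... | whole  Y e i′ = whole  Y e (m , i′)
... | cut-b  Y e i′ = cut-b  Y e (m , i′)
... | cut-ab Y e i′ = cut-ab Y e (m , i′)

-- Right special factors are the suffixes of the words bᴷ hᴷ(a) bᵗ

_SuffixOf_ : Word → Word → Set
w SuffixOf U = ∃[ p ] p ++ w ≡ U

suffixOf-trans : ∀ {w v U} → w SuffixOf v → v SuffixOf U → w SuffixOf U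
suffixOf-trans {w} (p , refl) (q , refl) = q ++ p , ++-assoc q p w

suffixOf-++ʳ : ∀ {w v} r → w SuffixOf v → (w ++ r) SuffixOf (v ++ r)
suffixOf-++ʳ {w} r (p , refl) = p , sym (++-assoc p w r)

suffixOf-++ : ∀ {w} X Y → w SuffixOf (X ++ Y) → w SuffixOf Y ⊎ ∃[ w₁ ] w ≡ w₁ ++ Y × w₁ SuffixOf X
suffixOf-++     X       Y ([]    , refl) = inj₂ (X , refl , ([] , refl))
suffixOf-++     []      Y (p     , e)    = inj₁ (p , e)
suffixOf-++ {w} (x ∷ X) Y (x′ ∷ p , e) with refl , e′ ← ∷-injective e with suffixOf-++ X Y (p , e′)
... | inj₁ w⊑Y                  = inj₁ w⊑Y
... | inj₂ (w₁ , e₁ , (q , e₂)) = inj₂ (w₁ , e₁ , (x ∷ q , cong (x ∷_) e₂))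

suffixOf-replicate : ∀ (x : Letter) {w} n → w SuffixOf replicate n x → w ≡ replicate (length w) x
suffixOf-replicate x n       ([]     , refl) = cong (λ m → replicate m x) (sym (length-replicate n))
suffixOf-replicate x (suc n) (x′ ∷ p , e)    = suffixOf-replicate x n (p , ∷-injectiveʳ e)

bᴷuᴷbᵗ : ℕ → ℕ → Word
bᴷuᴷbᵗ K t = replicate K b ++ u K ++ replicate t b

SpecialShape : Word → Set
SpecialShape w = ∃₂ λ K t → w SuffixOf bᴷuᴷbᵗ K t

b∷h-bᴷuᴷbᵗ : ∀ K t → b ∷ h (bᴷuᴷbᵗ K t) ≡ bᴷuᴷbᵗ (suc K) t
b∷h-bᴷuᴷbᵗ K t = cong (b ∷_) (begin
  h (replicate K b ++ u K ++ replicate t b)          ≡⟨ h-++ (replicate K b) _ ⟩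
  h (replicate K b) ++ h (u K ++ replicate t b)      ≡⟨ cong₂ _++_ (h-replicate-b K) (h-++ (u K) _) ⟩
  replicate K b ++ u (suc K) ++ h (replicate t b)    ≡⟨ cong (λ v → replicate K b ++ u (suc K) ++ v) (h-replicate-b t) ⟩
  replicate K b ++ u (suc K) ++ replicate t b        ∎)
  where open ≡-Reasoning

bᴷuᴷbᵗ-suc : ∀ K t → bᴷuᴷbᵗ K (suc t) ≡ bᴷuᴷbᵗ K t ∷ʳ b
bᴷuᴷbᵗ-suc K t = begin
  replicate K b ++ u K ++ replicate (suc t) b    ≡⟨ cong (λ v → replicate K b ++ u K ++ v) (replicate-∷ʳ b t) ⟩
  replicate K b ++ u K ++ replicate t b ∷ʳ b     ≡⟨ solve 4 (λ R U S B → R ⊕ (U ⊕ (S ⊕ B)) ⊜ (R ⊕ (U ⊕ S)) ⊕ B) refl (replicate K b) (u K) (replicate t b) [ b ] ⟩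
  bᴷuᴷbᵗ K t ∷ʳ b                                 ∎
  where open ≡-Reasoning

shape-b∷h : ∀ {W} → SpecialShape W → SpecialShape (b ∷ h W)
shape-b∷h {W} (K , t , P , e) with q , eq ← h-ends-with-b b P = suc K , t , q , (begin
  q ++ b ∷ h W          ≡⟨ sym (++-assoc q [ b ] (h W)) ⟩
  (q ∷ʳ b) ++ h W       ≡⟨ cong (_++ h W) (sym eq) ⟩
  b ∷ (h P ++ h W)      ≡⟨ cong (b ∷_) (sym (h-++ P W)) ⟩
  b ∷ h (P ++ W)        ≡⟨ cong (λ v → b ∷ h v) e ⟩
  b ∷ h (bᴷuᴷbᵗ K t)    ≡⟨ b∷h-bᴷuᴷbᵗ K t ⟩
  bᴷuᴷbᵗ (suc K) t      ∎)
  where open ≡-Reasoning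

factor-abᵗa : ∀ t → Factor (abᵗc t a)
factor-abᵗa zero    = 1 , [] , [ b ] , refl
factor-abᵗa (suc t) = factor-inner [ a ] (abᵗc (suc t) a) (a ∷ b ∷ []) (subst Factor eq (factor-h (factor-abᵗa t)))
  where
  eq : h (abᵗc t a) ≡ [ a ] ++ abᵗc (suc t) a ++ a ∷ b ∷ []
  eq = cong (λ v → a ∷ a ∷ b ∷ v) (trans (h-++ (replicate t b) [ a ]) (trans (cong (_++ h [ a ]) (h-replicate-b t))
         (sym (++-assoc (replicate t b) [ a ] (a ∷ b ∷ [])))))

-- Induction on K: left-extend, apply h, and cut off the trailing ab of h(a) = aab.
factor-bᴷuᴷbᵗa : ∀ K t → Factor (bᴷuᴷbᵗ K t ∷ʳ a)
factor-bᴷuᴷbᵗa zero    t = factor-abᵗa t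
factor-bᴷuᴷbᵗa (suc K) t with x , p ← factor-extendˡ (factor-bᴷuᴷbᵗa K t) =
  factor-prefix _ (a ∷ b ∷ []) (subst Factor eq (factor-b∷h x _ p))
  where
  eq : b ∷ h (bᴷuᴷbᵗ K t ∷ʳ a) ≡ (bᴷuᴷbᵗ (suc K) t ∷ʳ a) ++ a ∷ b ∷ []
  eq = begin
    b ∷ h (bᴷuᴷbᵗ K t ∷ʳ a)               ≡⟨ cong (b ∷_) (h-++ (bᴷuᴷbᵗ K t) [ a ]) ⟩
    (b ∷ h (bᴷuᴷbᵗ K t)) ++ a ∷ a ∷ b ∷ [] ≡⟨ cong (_++ a ∷ a ∷ b ∷ []) (b∷h-bᴷuᴷbᵗ K t) ⟩
    bᴷuᴷbᵗ (suc K) t ++ a ∷ a ∷ b ∷ []     ≡⟨ sym (++-assoc (bᴷuᴷbᵗ (suc K) t) [ a ] _) ⟩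
    (bᴷuᴷbᵗ (suc K) t ∷ʳ a) ++ a ∷ b ∷ []  ∎
    where open ≡-Reasoning

factor-bᴷuᴷbᵗ∷ʳ : ∀ K t c → Factor (bᴷuᴷbᵗ K t ∷ʳ c)
factor-bᴷuᴷbᵗ∷ʳ K t a = factor-bᴷuᴷbᵗa K t
factor-bᴷuᴷbᵗ∷ʳ K t b = factor-prefix _ [ a ] (subst (λ v → Factor (v ∷ʳ a)) (bᴷuᴷbᵗ-suc K t) (factor-bᴷuᴷbᵗa K (suc t)))

shape⇒rightSpecial : ∀ {w} → SpecialShape w → RightSpecial Factor w
shape⇒rightSpecial {w} (K , t , p , e) = factor-∷ʳ a , factor-∷ʳ b
  where
  factor-∷ʳ : ∀ c → Factor (w ∷ʳ c)
  factor-∷ʳ c = factor-suffix p _ (subst Factor (trans (cong (_∷ʳ c) (sym e)) (++-assoc p w [ c ])) (factor-bᴷuᴷbᵗ∷ʳ K t c))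

preimage-agree : ∀ {y W W′} → Preimage Factor y W → Preimage Factor y W′ →
                 ∃[ X ] length X ≤ length y × y SuffixOf (b ∷ h X) × Factor (X ++ W) × Factor (X ++ W′)
preimage-agree (whole Y e f) (whole Y′ refl f′) with refl ← h-injective Y′ Y e =
  Y , length-≤-length-h Y , ([ b ] , refl) , f , f′
preimage-agree (whole Y e f) (cut-b Y′ refl f′) with refl ← h≡b∷h⇒ Y Y′ (sym e) =
  Y′ , m≤n⇒m≤1+n (length-≤-length-h Y′) , ([] , refl) , factor-suffix [ b ] _ f , factor-suffix [ a ] _ f′
preimage-agree (cut-b Y e f) (whole Y′ refl f′) with refl ← h≡b∷h⇒ Y′ Y e =
  Y , m≤n⇒m≤1+n (length-≤-length-h Y) , ([] , refl) , factor-suffix [ a ] _ f , factor-suffix [ b ] _ f′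
preimage-agree (cut-b Y e f) (cut-b Y′ refl f′) with refl ← h-injective Y′ Y (∷-injectiveʳ e) =
  Y , m≤n⇒m≤1+n (length-≤-length-h Y) , ([] , refl) , factor-suffix [ a ] _ f , factor-suffix [ a ] _ f′
preimage-agree (cut-ab Y e f) (cut-ab Y′ refl f′) with refl ← h-injective Y′ Y (∷-injectiveʳ (∷-injectiveʳ e)) =
  a ∷ Y , s≤s (m≤n⇒m≤1+n (length-≤-length-h Y)) , (b ∷ a ∷ [] , refl) , f , f′
preimage-agree (cut-ab Y e _) (whole Y′ refl _) = ⊥-elim (h≢ab∷ Y′ _ e)
preimage-agree (whole Y e _) (cut-ab Y′ refl _) = ⊥-elim (h≢ab∷ Y _ (sym e))
preimage-agree (cut-b Y () _)  (cut-ab Y′ refl _)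
preimage-agree (cut-ab Y () _) (cut-b Y′ refl _)

shape-step : ∀ y t X → y SuffixOf (b ∷ h X) → SpecialShape (X ++ a ∷ replicate t b) →
             SpecialShape (y ++ a ∷ a ∷ b ∷ replicate t b)
shape-step y t X y⊑ shape with K , t′ , s ← shape-b∷h shape =
  K , t′ , suffixOf-trans (subst ((y ++ a ∷ a ∷ b ∷ replicate t b) SuffixOf_) (sym b∷h-X++abᵗ) (suffixOf-++ʳ _ y⊑)) s
  where
  b∷h-X++abᵗ : b ∷ h (X ++ a ∷ replicate t b) ≡ (b ∷ h X) ++ a ∷ a ∷ b ∷ replicate t b
  b∷h-X++abᵗ = cong (b ∷_) (trans (h-++ X _) (cong (λ v → h X ++ a ∷ a ∷ b ∷ v) (h-replicate-b t)))

rightSpecial-desubstitute : ∀ y t → RightSpecial Factor (y ++ a ∷ a ∷ b ∷ replicate t b) →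
  ∃[ X ] length X ≤ length y × y SuffixOf (b ∷ h X) × RightSpecial Factor (X ++ a ∷ replicate t b)
rightSpecial-desubstitute y t (fa , fb)
  with X , X≤y , y⊑ , fa′ , fb′ ← preimage-agree (factor-desubstitute y t a (subst Factor (++-assoc y _ [ a ]) fa))
                                                   (factor-desubstitute y t b (subst Factor (++-assoc y _ [ b ]) fb)) =
  X , X≤y , y⊑ , regroup a fa′ , regroup b fb′
  where
  regroup : ∀ c → Factor (X ++ abᵗc t c) → Factor ((X ++ a ∷ replicate t b) ∷ʳ c)
  regroup c = subst Factor (sym (++-assoc X _ [ c ]))

data BTail : Word → Set where
  bⁿ   : ∀ n → BTail (replicate n b)
  abⁿ  : ∀ n → BTail (a ∷ replicate n b)
  xabⁿ : ∀ y x n → BTail (y ++ x ∷ a ∷ replicate n b)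

bTail : ∀ w → BTail w
bTail []      = bⁿ 0
bTail (x ∷ w) with bTail w
bTail (a ∷ _) | bⁿ n        = abⁿ n
bTail (b ∷ _) | bⁿ n        = bⁿ (suc n)
bTail (x ∷ _) | abⁿ n       = xabⁿ [] x n
bTail (x ∷ _) | xabⁿ y x′ n = xabⁿ (x ∷ y) x′ n

-- Induction on the length: bab and aaa are not factors, and a right special y aab bᵗ
-- desubstitutes to the shorter right special X a bᵗ.
rightSpecial⇒shape : ∀ {w} → RightSpecial Factor w → SpecialShape w
rightSpecial⇒shape {w} = go (suc (length w)) w ≤-refl
  where
  go : ∀ n w → length w < n → RightSpecial Factor w → SpecialShape w
  go (suc n) w lt (fa , fb) with bTail w
  ... | bⁿ k             = 0 , k , ([ a ] , refl)
  ... | abⁿ t            = 0 , t , ([] , refl)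
  ... | xabⁿ y b zero    = ⊥-elim (bab-not-factor (factor-suffix y _ (factor-∷ʳ-assoc y _ b fb)))
  ... | xabⁿ y b (suc t) = ⊥-elim (bab-not-factor (factor-prefix _ (replicate t b ∷ʳ a) (factor-suffix y _ (factor-∷ʳ-assoc y _ a fa))))
  ... | xabⁿ y a zero    = ⊥-elim (aaa-not-factor (factor-suffix y _ (factor-∷ʳ-assoc y _ a fa)))
  ... | xabⁿ y a (suc t) with X , X≤y , y⊑ , rs′ ← rightSpecial-desubstitute y t (fa , fb) =
    shape-step y t X y⊑ (go n (X ++ a ∷ replicate t b) shorter rs′)
    where
    shorter : length (X ++ a ∷ replicate t b) < n
    shorter = <-≤-trans (length-++-< X y _ (a ∷ a ∷ b ∷ replicate t b) X≤y (s≤s (s≤s (n≤1+n _)))) (≤-pred lt)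

Valid : ℕ → ℕ → Set
Valid n ℓ = ℓ ≤ n × ℓ < 2 ^ suc (n ∸ ℓ)

-- rev(z[0..ℓ)) bⁿ⁻ˡ, with the prefix of z read off u n, which is long enough as ℓ ≤ n.
rsWord : ℕ → ℕ → Word
rsWord n ℓ = reverse (take ℓ (u n)) ++ replicate (n ∸ ℓ) b

take-u : ∀ {ℓ K n} → K ≤ n → ℓ ≤ length (u K) → take ℓ (u n) ≡ take ℓ (u K)
take-u {ℓ} {K} K≤n ℓ≤ with r , e ← u-prefix K≤n = trans (cong (take ℓ) e) (take-++ˡ ℓ (u K) r ℓ≤)

valid⇒shape : ∀ {n ℓ} → Valid n ℓ → SpecialShape (rsWord n ℓ)
valid⇒shape {n} {ℓ} (ℓ≤n , ℓ<) = K , 0 , (reverse (drop ℓ (u K)) , (begin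
  reverse (drop ℓ (u K)) ++ reverse (take ℓ (u n)) ++ bᴷ  ≡⟨ cong (λ v → reverse (drop ℓ (u K)) ++ reverse v ++ bᴷ) (take-u (m∸n≤m n ℓ) ℓ≤) ⟩
  reverse (drop ℓ (u K)) ++ reverse (take ℓ (u K)) ++ bᴷ  ≡⟨ ++-assoc (reverse (drop ℓ (u K))) _ bᴷ ⟨
  (reverse (drop ℓ (u K)) ++ reverse (take ℓ (u K))) ++ bᴷ ≡⟨ cong (_++ bᴷ) (reverse-++ (take ℓ (u K)) (drop ℓ (u K))) ⟨
  reverse (take ℓ (u K) ++ drop ℓ (u K)) ++ bᴷ            ≡⟨ cong (λ v → reverse v ++ bᴷ) (take++drop≡id ℓ (u K)) ⟩
  reverse (u K) ++ bᴷ                                    ≡⟨ bᴷ++u≡reverse-u++bᴷ K ⟨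
  bᴷ ++ u K                                              ≡⟨ cong (bᴷ ++_) (++-identityʳ (u K)) ⟨
  bᴷuᴷbᵗ K 0                                             ∎))
  where
  open ≡-Reasoning
  K : ℕ
  K = n ∸ ℓ
  bᴷ : Word
  bᴷ = replicate K b
  ℓ≤ : ℓ ≤ length (u K)
  ℓ≤ = ≤-pred (≤-trans ℓ< (≤-reflexive (sym (suc-length-u K))))

shape⇒valid : ∀ {w} → SpecialShape w → ∃[ ℓ ] Valid (length w) ℓ × w ≡ rsWord (length w) ℓ
shape⇒valid {w} (K , t , w⊑) with suffixOf-++ (reverse (u K)) (replicate (K + t) b) (subst (w SuffixOf_) B≡ w⊑)
  where
  B≡ : bᴷuᴷbᵗ K t ≡ reverse (u K) ++ replicate (K + t) b
  B≡ = begin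
    replicate K b ++ u K ++ replicate t b       ≡⟨ ++-assoc (replicate K b) (u K) _ ⟨
    (replicate K b ++ u K) ++ replicate t b     ≡⟨ cong (_++ replicate t b) (bᴷ++u≡reverse-u++bᴷ K) ⟩
    (reverse (u K) ++ replicate K b) ++ replicate t b ≡⟨ ++-assoc (reverse (u K)) _ _ ⟩
    reverse (u K) ++ replicate K b ++ replicate t b   ≡⟨ cong (reverse (u K) ++_) (replicate-++ b K t) ⟩
    reverse (u K) ++ replicate (K + t) b        ∎
    where open ≡-Reasoning
... | inj₁ w⊑bʲ = 0 , (z≤n , m^n>0 2 (suc (length w))) , suffixOf-replicate b _ w⊑bʲ
... | inj₂ (w₁ , refl , (p , e)) = ℓ , (ℓ≤n , ℓ<) , cong₂ _++_ w₁≡ (cong (λ m → replicate m b) (sym n∸ℓ≡j))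
  where
  ℓ j n : ℕ
  ℓ = length w₁
  j = K + t
  n = length (w₁ ++ replicate j b)
  n≡ : n ≡ ℓ + j
  n≡ = trans (length-++ w₁) (cong (ℓ +_) (length-replicate j))
  n∸ℓ≡j : n ∸ ℓ ≡ j
  n∸ℓ≡j = trans (cong (_∸ ℓ) n≡) (m+n∸m≡n ℓ j)
  ℓ≤n : ℓ ≤ n
  ℓ≤n = ≤-trans (m≤m+n ℓ j) (≤-reflexive (sym n≡))
  uᴷ≡ : u K ≡ reverse w₁ ++ reverse p
  uᴷ≡ = trans (sym (reverse-involutive (u K))) (trans (cong reverse (sym e)) (reverse-++ p w₁))
  ℓ≤uᴷ : ℓ ≤ length (u K)
  ℓ≤uᴷ = begin
    ℓ                       ≤⟨ m≤n+m ℓ (length p) ⟩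
    length p + ℓ            ≡⟨ length-++ p ⟨
    length (p ++ w₁)        ≡⟨ cong length e ⟩
    length (reverse (u K))  ≡⟨ length-reverse (u K) ⟩
    length (u K)            ∎
    where open ≤-Reasoning
  ℓ< : ℓ < 2 ^ suc (n ∸ ℓ)
  ℓ< = ≤-trans (s≤s ℓ≤uᴷ) (≤-trans (≤-reflexive (suc-length-u K)) (^-monoʳ-≤ 2 (s≤s (≤-trans (m≤m+n K t) (≤-reflexive (sym n∸ℓ≡j))))))
  w₁≡ : w₁ ≡ reverse (take ℓ (u n))
  w₁≡ = begin
    w₁                                        ≡⟨ reverse-involutive w₁ ⟨
    reverse (reverse w₁)                      ≡⟨ cong reverse (take-length-++ (reverse w₁) (reverse p)) ⟨
    reverse (take (length (reverse w₁)) (reverse w₁ ++ reverse p)) ≡⟨ cong (λ m → reverse (take m (reverse w₁ ++ reverse p))) (length-reverse w₁) ⟩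
    reverse (take ℓ (reverse w₁ ++ reverse p)) ≡⟨ cong (reverse ∘ take ℓ) uᴷ≡ ⟨
    reverse (take ℓ (u K))                     ≡⟨ cong reverse (take-u (≤-trans (≤-trans (m≤m+n K t) (m≤n+m j ℓ)) (≤-reflexive (sym n≡))) ℓ≤uᴷ) ⟨
    reverse (take ℓ (u n))                     ∎
    where open ≡-Reasoning

length-rsWord : ∀ {n ℓ} → ℓ ≤ n → length (rsWord n ℓ) ≡ n
length-rsWord {n} {ℓ} ℓ≤n = begin
  length (rsWord n ℓ)                                    ≡⟨ length-++ (reverse (take ℓ (u n))) ⟩
  length (reverse (take ℓ (u n))) + length (replicate (n ∸ ℓ) b) ≡⟨ cong₂ _+_ (length-reverse (take ℓ (u n))) (length-replicate (n ∸ ℓ)) ⟩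
  length (take ℓ (u n)) + (n ∸ ℓ)                        ≡⟨ cong (_+ (n ∸ ℓ)) (trans (length-take ℓ (u n)) (m≤n⇒m⊓n≡m (≤-trans ℓ≤n (n≤length-u n)))) ⟩
  ℓ + (n ∸ ℓ)                                            ≡⟨ m+[n∸m]≡n ℓ≤n ⟩
  n                                                      ∎
  where open ≡-Reasoning

leadingBs : Word → ℕ
leadingBs (b ∷ w) = suc (leadingBs w)
leadingBs _       = 0

leadingBs-reverse-rsWord : ∀ n ℓ → leadingBs (reverse (rsWord n ℓ)) ≡ n ∸ ℓ
leadingBs-reverse-rsWord n ℓ = trans (cong leadingBs reverse-rsWord) (leadingBs-bᵐ++take (n ∸ ℓ) ℓ)
  where
  reverse-rsWord : reverse (rsWord n ℓ) ≡ replicate (n ∸ ℓ) b ++ take ℓ (u n)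
  reverse-rsWord = trans (reverse-++ (reverse (take ℓ (u n))) _)
                         (cong₂ _++_ (reverse-replicate b (n ∸ ℓ)) (reverse-involutive (take ℓ (u n))))
  leadingBs-bᵐ++take : ∀ m ℓ → leadingBs (replicate m b ++ take ℓ (u n)) ≡ m
  leadingBs-bᵐ++take (suc m) ℓ       = cong suc (leadingBs-bᵐ++take m ℓ)
  leadingBs-bᵐ++take zero    zero    = refl
  leadingBs-bᵐ++take zero    (suc ℓ) with r , e ← u-starts-with-a n = cong (leadingBs ∘ take (suc ℓ)) e

rsWord-injective : ∀ {n ℓ ℓ′} → ℓ ≤ n → ℓ′ ≤ n → rsWord n ℓ ≡ rsWord n ℓ′ → ℓ ≡ ℓ′
rsWord-injective {n} {ℓ} {ℓ′} ℓ≤n ℓ′≤n e = ∸-cancelˡ-≡ ℓ≤n ℓ′≤n (begin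
  n ∸ ℓ                              ≡⟨ leadingBs-reverse-rsWord n ℓ ⟨
  leadingBs (reverse (rsWord n ℓ))   ≡⟨ cong (leadingBs ∘ reverse) e ⟩
  leadingBs (reverse (rsWord n ℓ′))  ≡⟨ leadingBs-reverse-rsWord n ℓ′ ⟩
  n ∸ ℓ′                             ∎)
  where open ≡-Reasoning

valid? : ∀ n ℓ → Dec (Valid n ℓ)
valid? n ℓ = (ℓ ≤? n) ×-dec (ℓ <? 2 ^ suc (n ∸ ℓ))

validLengths : ℕ → List ℕ
validLengths n = filter (valid? n) (upTo (suc n))

rsWords : ℕ → List Word
rsWords n = map (rsWord n) (validLengths n)

rsWords-enumerate : ∀ n → Enumerates (RightSpecial Factor) n (rsWords n)
rsWords-enumerate n = unique , sound , complete
  where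
  valid : All (Valid n) (validLengths n)
  valid = All.all-filter (valid? n) (upTo (suc n))
  unique : Unique (rsWords n)
  unique = map⁺-on (λ (ℓ≤n , _) (ℓ′≤n , _) → rsWord-injective ℓ≤n ℓ′≤n) valid (Unique.filter⁺ (valid? n) (Unique.upTo⁺ (suc n)))
  sound : All (λ w → length w ≡ n × RightSpecial Factor w) (rsWords n)
  sound = All.map⁺ (All.map (λ v → length-rsWord (proj₁ v) , shape⇒rightSpecial (valid⇒shape v)) valid)
  complete : ∀ w → length w ≡ n → RightSpecial Factor w → w ∈ rsWords n
  complete w len rs with ℓ , v , e ← shape⇒valid (rightSpecial⇒shape rs) =
    subst (λ m → w ∈ rsWords m) len (subst (_∈ rsWords (length w)) (sym e)
      (∈-map⁺ (rsWord (length w)) (∈-filter⁺ (valid? (length w)) (∈-upTo⁺ (s≤s (proj₁ v))) v)))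

valid⇒< : ∀ {i v n ℓ} → 2 ^ i ≤ v → suc n ≡ v + i → Valid n ℓ → ℓ < v
valid⇒< {i} {v} {n} {ℓ} 2ⁱ≤v n≡ (ℓ≤n , ℓ<2^) = ≰⇒> v≰ℓ
  where
  v≰ℓ : ¬ v ≤ ℓ
  v≰ℓ v≤ℓ = <⇒≱ ℓ<2^ (begin
    2 ^ suc (n ∸ ℓ)  ≤⟨ ^-monoʳ-≤ 2 (begin
      suc (n ∸ ℓ)    ≡⟨ +-∸-assoc 1 ℓ≤n ⟨
      suc n ∸ ℓ      ≤⟨ ∸-monoʳ-≤ (suc n) v≤ℓ ⟩
      suc n ∸ v      ≡⟨ cong (_∸ v) n≡ ⟩
      v + i ∸ v      ≡⟨ m+n∸m≡n v i ⟩
      i              ∎) ⟩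
    2 ^ i            ≤⟨ 2ⁱ≤v ⟩
    v                ≤⟨ v≤ℓ ⟩
    ℓ                ∎)
    where open ≤-Reasoning

<⇒valid : ∀ {i v n ℓ} → v ≤ 2 ^ suc i → suc n ≡ v + i → ℓ < v → Valid n ℓ
<⇒valid {i} {v} {n} {ℓ} v≤2^ n≡ ℓ<v = m+n≤o⇒n≤o i i+ℓ≤n , (begin-strict
  ℓ                <⟨ ℓ<v ⟩
  v                ≤⟨ v≤2^ ⟩
  2 ^ suc i        ≤⟨ ^-monoʳ-≤ 2 (s≤s (m+n≤o⇒m≤o∸n i i+ℓ≤n)) ⟩
  2 ^ suc (n ∸ ℓ)  ∎)
  where
  open ≤-Reasoning
  i+ℓ≤n : i + ℓ ≤ n
  i+ℓ≤n = ≤-pred (begin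
    suc (i + ℓ) ≡⟨ +-suc i ℓ ⟨
    i + suc ℓ   ≤⟨ +-monoʳ-≤ i ℓ<v ⟩
    i + v       ≡⟨ +-comm i v ⟩
    v + i       ≡⟨ n≡ ⟨
    suc n       ∎)

-- v lies in the block [2ⁱ..2ⁱ⁺¹] and sits at position n of the concatenation of the blocks.
InBlock : ℕ → ℕ → Set
InBlock n v = ∃[ i ] 2 ^ i ≤ v × v ≤ 2 ^ suc i × suc n ≡ v + i

length-validLengths : ∀ {n v} → InBlock n v → length (validLengths n) ≡ v
length-validLengths {n} {v} (i , 2ⁱ≤v , v≤2^ , n≡) =
  length-filter-upTo (valid? n) (<⇒valid v≤2^ n≡) (λ v≤ℓ valid → <⇒≱ (valid⇒< 2ⁱ≤v n≡ valid) v≤ℓ)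
                     (≤-trans (m≤m+n v i) (≤-reflexive (sym n≡)))

blocks-suc : ∀ k → blocks (suc k) ≡ blocks k ++ interval (2 ^ k) (2 ^ suc k)
blocks-suc k = begin
  concatMap block (upTo (suc k))          ≡⟨ cong (concatMap block) (upTo-∷ʳ k) ⟨
  concatMap block (upTo k ∷ʳ k)           ≡⟨ concatMap-++ block (upTo k) [ k ] ⟩
  blocks k ++ block k ++ []               ≡⟨ cong (blocks k ++_) (++-identityʳ (block k)) ⟩
  blocks k ++ block k                     ∎
  where
  open ≡-Reasoning
  block : ℕ → List ℕ
  block i = interval (2 ^ i) (2 ^ suc i)

2^suc∸2^ : ∀ k → 2 ^ suc k ∸ 2 ^ k ≡ 2 ^ k
2^suc∸2^ k = trans (cong (λ m → 2 ^ k + m ∸ 2 ^ k) (+-identityʳ (2 ^ k))) (m+n∸m≡n (2 ^ k) (2 ^ k))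

length-interval : ∀ k → length (interval (2 ^ k) (2 ^ suc k)) ≡ suc (2 ^ k)
length-interval k = trans (length-applyUpTo (2 ^ k +_) _) (cong suc (2^suc∸2^ k))

suc-length-blocks : ∀ k → suc (length (blocks k)) ≡ 2 ^ k + k
suc-length-blocks zero    = refl
suc-length-blocks (suc k) = begin
  suc (length (blocks (suc k)))                       ≡⟨ cong (suc ∘ length) (blocks-suc k) ⟩
  suc (length (blocks k ++ interval (2 ^ k) _))       ≡⟨ cong suc (length-++ (blocks k)) ⟩
  suc (length (blocks k) + length (interval (2 ^ k) _)) ≡⟨ cong₂ _+_ (suc-length-blocks k) (length-interval k) ⟩
  (2 ^ k + k) + suc (2 ^ k)                            ≡⟨ solve-+ (2 ^ k) k ⟩
  2 ^ suc k + suc k                                    ∎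
  where
  open ≡-Reasoning
  solve-+ : ∀ p k → (p + k) + suc p ≡ 2 * p + suc k
  solve-+ = solve-∀

last-block-inBlock : ∀ k {o} → o ≤ 2 ^ k → InBlock (length (blocks k) + o) (2 ^ k + o)
last-block-inBlock k {o} o≤2ᵏ =
  k , m≤m+n (2 ^ k) o , +-monoʳ-≤ (2 ^ k) (≤-trans o≤2ᵏ (≤-reflexive (sym (+-identityʳ (2 ^ k))))) ,
  trans (cong (_+ o) (suc-length-blocks k)) (+-exchange (2 ^ k) k o)
  where
  +-exchange : ∀ p k o → (p + k) + o ≡ (p + o) + k
  +-exchange = solve-∀

blocks-inBlock : ∀ k {n} → n < length (blocks k) → InBlock n (blocks k ! n)
blocks-inBlock (suc k) {n} n< rewrite blocks-suc k with n <? length (blocks k)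
... | yes n<L = subst (InBlock n) (sym (!-++ˡ (blocks k) _ n<L)) (blocks-inBlock k n<L)
... | no  n≮L = subst (λ m → InBlock m ((blocks k ++ I) ! m)) (m+[n∸m]≡n L≤n) (subst (InBlock _) (sym entry) (last-block-inBlock k o≤2ᵏ))
  where
  L : ℕ
  L = length (blocks k)
  I : List ℕ
  I = interval (2 ^ k) (2 ^ suc k)
  L≤n : L ≤ n
  L≤n = ≮⇒≥ n≮L
  o≤2ᵏ : n ∸ L ≤ 2 ^ k
  o≤2ᵏ = ≤-pred (begin
    suc (n ∸ L)         ≡⟨ +-∸-assoc 1 L≤n ⟨
    suc n ∸ L           ≤⟨ ∸-monoˡ-≤ L (subst (n <_) (trans (cong length (blocks-suc k)) (trans (length-++ (blocks k)) (cong (L +_) (length-interval k)))) n<) ⟩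
    L + suc (2 ^ k) ∸ L ≡⟨ m+n∸m≡n L _ ⟩
    suc (2 ^ k)         ∎)
    where open ≤-Reasoning
  entry : (blocks k ++ I) ! (L + (n ∸ L)) ≡ 2 ^ k + (n ∸ L)
  entry = trans (!-++ʳ (blocks k) I (n ∸ L)) (!-applyUpTo (2 ^ k +_) _ (s≤s (≤-trans o≤2ᵏ (≤-reflexive (sym (2^suc∸2^ k))))))

length-rsWords : ∀ n k (n< : n < length (blocks k)) → length (rsWords n) ≡ lookup (blocks k) (fromℕ< n<)
length-rsWords n k n< = begin
  length (rsWords n)          ≡⟨ length-map (rsWord n) (validLengths n) ⟩
  length (validLengths n)     ≡⟨ length-validLengths (blocks-inBlock k n<) ⟩
  blocks k ! n                ≡⟨ lookup-fromℕ< (blocks k) n< ⟨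
  lookup (blocks k) (fromℕ< n<) ∎
  where open ≡-Reasoning

-- The fixed point z

slice-∷ʳ : ∀ z i w (x : Letter) → slice z i (length (w ∷ʳ x)) ≡ slice z i (length w) ∷ʳ z (i + length w)
slice-∷ʳ z i w x = trans (cong (slice z i) (length-∷ʳ w x)) (sym (applyUpTo-∷ʳ (λ j → z (i + j)) (length w)))

isFactor-init : ∀ z {w x} → IsFactor z (w ∷ʳ x) → IsFactor z w
isFactor-init z {w} {x} (i , e) = i , ∷ʳ-injectiveˡ _ w (trans (sym (slice-∷ʳ z i w x)) e)

isFactor-extend : ∀ z {w} → IsFactor z w → ∃[ x ] IsFactor z (w ∷ʳ x)
isFactor-extend z {w} (i , e) = z (i + length w) , i , trans (slice-∷ʳ z i w _) (cong (_∷ʳ z (i + length w)) e)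

module _ {z : InfWord} (fixed : IsFixedPointFromA z) where

  isFactor⇒factor : ∀ {w} → IsFactor z w → Factor w
  isFactor⇒factor {w} (i , e) = m , applyUpTo z i , rest , (begin
    u m                                         ≡⟨ fixed m ⟨
    applyUpTo z (length (u m))                  ≡⟨ cong (applyUpTo z) |u|≡ ⟩
    applyUpTo z (i + (length w + d))            ≡⟨ applyUpTo-+ z i (length w + d) ⟩
    applyUpTo z i ++ slice z i (length w + d)   ≡⟨ cong (applyUpTo z i ++_) (applyUpTo-+ (λ j → z (i + j)) (length w) d) ⟩
    applyUpTo z i ++ slice z i (length w) ++ rest ≡⟨ cong (λ v → applyUpTo z i ++ v ++ rest) e ⟩
    applyUpTo z i ++ w ++ rest                  ∎)
    where
    open ≡-Reasoning
    m d : ℕ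
    m = i + length w
    d = length (u m) ∸ m
    rest : Word
    rest = applyUpTo (λ j → z (i + (length w + j))) d
    |u|≡ : length (u m) ≡ i + (length w + d)
    |u|≡ = trans (sym (m+[n∸m]≡n (n≤length-u m))) (+-assoc i (length w) d)

  factor⇒isFactor : ∀ {w} → Factor w → IsFactor z w
  factor⇒isFactor {w} (m , P , Q , e) =
    length P , proj₁ (++-injective (slice z (length P) (length w)) w (length-applyUpTo _ (length w))
                       (proj₂ (++-injective (applyUpTo z (length P)) P (length-applyUpTo z (length P)) prefix≡)))
    where
    open ≡-Reasoning
    zᴾ rest : Word
    zᴾ = applyUpTo z (length P)
    rest = applyUpTo (λ j → z (length P + (length w + j))) (length Q)
    prefix≡ : zᴾ ++ slice z (length P) (length w) ++ rest ≡ P ++ w ++ Q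
    prefix≡ = begin
      zᴾ ++ slice z (length P) (length w) ++ rest     ≡⟨ cong (zᴾ ++_) (applyUpTo-+ (λ j → z (length P + j)) (length w) (length Q)) ⟨
      zᴾ ++ slice z (length P) (length w + length Q)  ≡⟨ applyUpTo-+ z (length P) _ ⟨
      applyUpTo z (length P + (length w + length Q))  ≡⟨ cong (applyUpTo z) (trans (length-++ P) (cong (length P +_) (length-++ w))) ⟨
      applyUpTo z (length (P ++ w ++ Q))              ≡⟨ cong (applyUpTo z ∘ length) e ⟨
      applyUpTo z (length (u m))                      ≡⟨ fixed m ⟩
      u m                                             ≡⟨ e ⟩
      P ++ w ++ Q                                     ∎

  rsWords-enumerate-factors : ∀ n → Enumerates (RightSpecial (IsFactor z)) n (rsWords n)
  rsWords-enumerate-factors n =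
    enumerates-⇔ (×-map factor⇒isFactor factor⇒isFactor) (×-map isFactor⇒factor isFactor⇒factor) (rsWords-enumerate n)

  complexity-step : ∀ {n L} → Enumerates (IsFactor z) n L →
                    ∃[ L′ ] Enumerates (IsFactor z) (suc n) L′ × length L′ ≡ length L + length (rsWords n)
  complexity-step {n} {L} enum =
    enumerates-suc {P = IsFactor z} {n} {L} {rsWords n} (isFactor-init z) (isFactor-extend z) enum (rsWords-enumerate-factors n)

  factors-enumerated : ∀ n → ∃[ L ] Enumerates (IsFactor z) n L
  factors-enumerated zero    = [ [] ] , ([] ∷ []) , ((refl , 0 , refl) ∷ []) , λ { [] _ _ → here refl ; (_ ∷ _) () _ }
  factors-enumerated (suc n) = ×-map id proj₁ (complexity-step (proj₂ (factors-enumerated n)))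

  complexity-recurrence : ∀ n → ∃₂ λ L L′ → Enumerates (IsFactor z) n L × Enumerates (IsFactor z) (suc n) L′ ×
                                             length L′ ≡ length L + length (rsWords n)
  complexity-recurrence n =
    let L , enum = factors-enumerated n
        L′ , enum′ , |L′|≡ = complexity-step enum
    in L , L′ , enum , enum′ , |L′|≡

enumerates⇒isComplexity : ∀ z {n L} → Enumerates (IsFactor z) n L → IsComplexity z n (length L)
enumerates⇒isComplexity z {L = L} (unique , sound , complete) = L , unique , sound , complete , refl

corollary13 : (z : InfWord) → IsFixedPointFromA z →
    (n : ℕ) → ∃[ r ] ∃[ r′ ] (IsComplexity z n r × IsComplexity z (suc n) r′ ×
    ((k : ℕ) (lt : n < length (blocks k)) → r′ ≡ r + lookup (blocks k) (fromℕ< lt)))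
corollary13 z fixed n =
  let L , L′ , enum , enum′ , |L′|≡ = complexity-recurrence fixed n in
  length L , length L′ , enumerates⇒isComplexity z enum , enumerates⇒isComplexity z enum′ ,
  λ k n< → trans |L′|≡ (cong (length L +_) (length-rsWords n k n<))
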